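{- Let $p$ be an odd prime, $q=p^h$, $l>1$, and let $\beta,\beta'$ be two nonsquares in $\mathbb{F}_{q^{2l}}$. Let $d$ be a positive integer with $\gcd(d,l)=1$ and $l+d$ odd. Then $\gcd(q^d+1,q^l+1)=2$, and there exist nonzero $b_0,b_1\in\mathbb{F}_{q^{2l}}$ such that $$\beta'\beta^{ -1}b_0^{q^d+1}\in\mathbb{F}_{q^l},\qquad \beta^{1-q^{2l-d}}b_1^{q^{2l-d}+1}\in\mathbb{F}_{q^l}.$$
   Context: For elements of $\mathbb{F}_{q^{2l}}$, a power $x^{q^{k}}$ with $k$ possibly negative is understood as $x^{q^{m}}$ with $m\ge0$, $m\equiv k\pmod{2l}$ (i.e. via the Frobenius automorphism). -}

module Defs where

open import Level using (Level; _⊔_; suc)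
open import Data.Nat using (ℕ; zero; suc)
import Data.Nat as N
open import Data.Fin using (Fin)
open import Data.Product using (Σ; _×_; _,_; ∃)
open import Relation.Nullary using (¬_)
open import Algebra.Bundles using (CommutativeRing)
import Algebra.Bundles
open import Function.Bundles using (Inverse)
import Relation.Binary.PropositionalEquality as P
import Algebra.Definitions.RawSemiring as RS

record Field (c ℓ : Level) : Set (Level.suc (c ⊔ ℓ)) where
  field
    commRing : CommutativeRing c ℓ
  open CommutativeRing commRing public
  field
    _⁻¹     : Carrier → Carrier
    1≉0     : ¬ (1# ≈ 0#)
    ⁻¹-inverse : ∀ x → ¬ (x ≈ 0#) → x * (x ⁻¹) ≈ 1#
  open RS (Algebra.Bundles.Semiring.rawSemiring semiring) public using (_^_)

HasCard : ∀ {c ℓ} → Field c ℓ → ℕ → Set (c ⊔ ℓ)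
HasCard F n = Inverse (Field.setoid F) (P.setoid (Fin n))

module _ {c ℓ} (F : Field c ℓ) where
  open Field F

  NonSquare : Carrier → Set (c ⊔ ℓ)
  NonSquare x = ¬ (∃ λ y → y * y ≈ x)

  -- x lies in the subfield F_{q^l}, i.e. is fixed by x ↦ x^{q^l}
  InSub : ℕ → ℕ → Carrier → Set ℓ
  InSub q l x = x ^ (q N.^ l) ≈ x

-- For l ≥ 1, negExp l d is the representative m ∈ [0, 2l) of 2l - d mod 2l,
-- so that x^{q^{2l-d}} is read as x^{q^m} (Frobenius convention).
negExp : ℕ → ℕ → ℕ
negExp zero d = zero
negExp l@(suc _) d = (2 N.* l N.∸ d N.% (2 N.* l)) N.% (2 N.* l)

-- For a common divisor g of q^d + 1 and q^l + 1, work in ℤ/gℤ: there x = q satisfies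
-- x^d = x^l = -1, a Bézout relation between the coprime d and l forces x² = 1, and as one of
-- d, l is even this makes 1 = -1, so g ∣ 2. For 2l - d in place of d, x^(2l) = 1 turns
-- x^(2l-d) = -1 back into x^d = -1. On the field side, pairing every nonzero y with a/y in the
-- product of all nonzero elements (Wilson's argument) gives Euler's criterion in F = F_{q^{2l}}:
-- a^((|F|-1)/2) is -1 for nonsquares and 1 for squares. Hence β′/β = s² and y^(|F|-1) = 1.
-- Writing 2 + a(r+1) = k(q^l+1), as gcd(r+1, q^l+1) = 2 allows, b₀ = s^a and b₁ = β^(1+a) turn
-- both expressions into k(q^l+1)-th powers, which y ↦ y^(q^l) fixes because
-- (q^l+1)·q^l ≡ q^l+1 modulo |F| - 1 = q^(2l) - 1.

module Submission where

open import Level using (0ℓ; _⊔_)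
open import Function using (_∘_; id)
open import Function.Bundles using (Inverse)
import Data.Nat as ℕ
open import Data.Nat using (ℕ; zero; suc; s≤s)
import Data.Nat.Properties as ℕ
import Data.Nat.Divisibility as ℕ
open import Data.Nat.DivMod using (m%n<n; %-distribˡ-+; %-distribˡ-*; m≡m%n+[m/n]*n; m<n⇒m%n≡m)
open import Data.Nat.GCD using (gcd; gcd-greatest; gcd[m,n]∣m; gcd[m,n]∣n; GCD; gcd-GCD; module Bézout)
open import Data.Nat.Coprimality using (gcd≡1⇒coprime; coprime-Bézout)
import Data.Nat.Tactic.RingSolver as ℕ-Solver
open import Data.Fin using (Fin)
import Data.Fin.Properties as Fin
open import Data.Product using (∃; ∃₂; _×_; _,_; proj₁; proj₂)
import Data.Sum as Sum
open Sum using (_⊎_; inj₁; inj₂; [_,_]′)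
open import Data.List using (List; []; _∷_; length; filter; allFin)
open import Data.List.Properties using (filter-reject; filter-none; length-tabulate)
open import Data.List.Membership.Propositional using (_∈_; _∉_)
open import Data.List.Membership.Propositional.Properties using (∈-allFin; ∈-filter⁺; ∈-filter⁻)
open import Data.List.Relation.Unary.Any using (here; there)
import Data.List.Relation.Unary.All as All
open import Data.List.Relation.Unary.AllPairs as AllPairs using ([]; _∷_)
open import Data.List.Relation.Unary.Unique.Propositional using (Unique)
open import Data.List.Relation.Unary.Unique.Propositional.Properties using (allFin⁺; filter⁺)
open import Relation.Nullary using (¬_; Dec; yes; no; contradiction)
import Relation.Nullary.Decidable as Dec
open import Relation.Binary.Definitions using (DecidableEquality)
open import Relation.Binary.PropositionalEquality as ≡ using (_≡_; _≢_)
open import Algebra.Bundles using (CommutativeRing; CommutativeSemiring)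
open import Defs

module Arithmetic where

  open import Data.Nat using (_+_; _*_; _^_; _%_; _/_; _<_; _≤_; _∸_)
  open import Data.Nat.Divisibility using (_∣_; divides; ∣1⇒≡1; ∣-refl; m%n≡0⇒n∣m)
  open ≡ using (refl; sym; trans; cong; cong₂; subst; module ≡-Reasoning)

  %2≡0⊎%2≡1 : ∀ m → m % 2 ≡ 0 ⊎ m % 2 ≡ 1
  %2≡0⊎%2≡1 m with m % 2 | m%n<n m 2
  ... | 0 | _ = inj₁ refl
  ... | 1 | _ = inj₂ refl
  ... | suc (suc _) | s≤s (s≤s ())

  [m+n]%2≡1⇒2∣n⊎2∣m : ∀ m n → (m + n) % 2 ≡ 1 → 2 ∣ n ⊎ 2 ∣ m
  [m+n]%2≡1⇒2∣n⊎2∣m m n m+n-odd with %2≡0⊎%2≡1 n | %2≡0⊎%2≡1 m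
  ... | inj₁ n-even | _ = inj₁ (m%n≡0⇒n∣m n 2 n-even)
  ... | inj₂ _ | inj₁ m-even = inj₂ (m%n≡0⇒n∣m m 2 m-even)
  ... | inj₂ n-odd | inj₂ m-odd = contradiction m+n-even λ ()
    where
    m+n-even : 1 ≡ 0
    m+n-even = trans (sym m+n-odd)
      (trans (%-distribˡ-+ m n 2) (cong₂ (λ a b → (a + b) % 2) m-odd n-odd))

  ^%2≡1 : ∀ {m} n → m % 2 ≡ 1 → m ^ n % 2 ≡ 1
  ^%2≡1 zero _ = refl
  ^%2≡1 {m} (suc n) m-odd = begin
    m * m ^ n % 2                ≡⟨ %-distribˡ-* m (m ^ n) 2 ⟩
    (m % 2) * (m ^ n % 2) % 2    ≡⟨ cong₂ (λ a b → a * b % 2) m-odd (^%2≡1 n m-odd) ⟩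
    1                            ∎
    where open ≡-Reasoning

  %2≡1⇒≡1+2*[m/2] : ∀ {m} → m % 2 ≡ 1 → m ≡ suc (2 * (m / 2))
  %2≡1⇒≡1+2*[m/2] {m} m-odd =
    trans (m≡m%n+[m/n]*n m 2) (cong₂ _+_ m-odd (ℕ.*-comm (m / 2) 2))

  %2≡1⇒2∣[m+1] : ∀ {m} → m % 2 ≡ 1 → 2 ∣ m + 1
  %2≡1⇒2∣[m+1] {m} m-odd = m%n≡0⇒n∣m (m + 1) 2
    (trans (%-distribˡ-+ m 1 2) (cong (λ a → (a + 1) % 2) m-odd))

  gcd[m,n+1]≡g⇒g+a*m≡k*[n+1] : ∀ {g} m n → gcd m (n + 1) ≡ g → ∃₂ λ a k → g + a * m ≡ k * (n + 1)
  gcd[m,n+1]≡g⇒g+a*m≡k*[n+1] {g} m n gcd≡g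
    with Bézout.identity (subst (GCD m (n + 1)) gcd≡g (gcd-GCD m (n + 1)))
  ... | Bézout.-+ x y eq = x , y , eq
  ... | Bézout.+- x y eq = x * n , g + n * y , (begin
    g + x * n * m            ≡⟨ ℕ-Solver.solve (g ∷ x ∷ n ∷ m ∷ []) ⟩
    g + x * m * n            ≡⟨ cong (λ xm → g + xm * n) (sym eq) ⟩
    g + (g + y * (n + 1)) * n  ≡⟨ ℕ-Solver.solve (g ∷ y ∷ n ∷ []) ⟩
    (g + n * y) * (n + 1)    ∎)
    where open ≡-Reasoning

  negExp-complement : ∀ {l d} → 1 < l → gcd d l ≡ 1 →
                      ∃₂ λ e t → negExp l d + e ≡ 2 * l × d ≡ e + t * (2 * l)
  negExp-complement {l@(suc _)} {d} 1<l gcd≡1 =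
    d % (2 * l) , d / (2 * l) , negExp+e≡2l , m≡m%n+[m/n]*n d (2 * l)
    where
    open ≡-Reasoning
    l∤d : ¬ (l ∣ d)
    l∤d l∣d = ℕ.<-irrefl (sym (∣1⇒≡1 (subst (l ∣_) gcd≡1 (gcd-greatest l∣d ∣-refl)))) 1<l
    0<e : 0 < d % (2 * l)
    0<e = ℕ.n≢0⇒n>0 λ e≡0 → l∤d (divides (d / (2 * l) * 2) (begin
      d                                   ≡⟨ m≡m%n+[m/n]*n d (2 * l) ⟩
      d % (2 * l) + d / (2 * l) * (2 * l) ≡⟨ cong (_+ d / (2 * l) * (2 * l)) e≡0 ⟩
      d / (2 * l) * (2 * l)               ≡⟨ ℕ.*-assoc (d / (2 * l)) 2 l ⟨
      d / (2 * l) * 2 * l                 ∎))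
    e≤2l : d % (2 * l) ≤ 2 * l
    e≤2l = ℕ.<⇒≤ (m%n<n d (2 * l))
    negExp+e≡2l : negExp l d + d % (2 * l) ≡ 2 * l
    negExp+e≡2l = begin
      (2 * l ∸ d % (2 * l)) % (2 * l) + d % (2 * l)
        ≡⟨ cong (_+ d % (2 * l)) (m<n⇒m%n≡m (ℕ.∸-monoʳ-< 0<e e≤2l)) ⟩
      2 * l ∸ d % (2 * l) + d % (2 * l)
        ≡⟨ ℕ.m∸n+n≡m e≤2l ⟩
      2 * l ∎

open Arithmetic

module RingLemmas {c ℓ} (R : CommutativeRing c ℓ) where

  open CommutativeRing R
  open import Algebra.Properties.Ring ring using (-‿distribˡ-*; -‿distribʳ-*; -‿involutive)
  open import Algebra.Properties.Semiring.Exp semiring public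
    using (_^_; ^-congˡ; ^-congʳ; ^-homo-*; ^-assocʳ)
  open import Algebra.Properties.CommutativeSemiring.Exp commutativeSemiring using (^-distrib-*)
  open import Algebra.Properties.CommutativeSemigroup *-commutativeSemigroup using (interchange)
  open import Relation.Binary.Reasoning.Setoid setoid

  1^n≈1 : ∀ n → 1# ^ n ≈ 1#
  1^n≈1 zero = refl
  1^n≈1 (suc n) = trans (*-identityˡ _) (1^n≈1 n)

  -x*-x≈x*x : ∀ x → - x * - x ≈ x * x
  -x*-x≈x*x x = begin
    - x * - x      ≈⟨ -‿distribˡ-* x (- x) ⟨
    - (x * - x)    ≈⟨ -‿cong (-‿distribʳ-* x x) ⟨
    - (- (x * x))  ≈⟨ -‿involutive (x * x) ⟩
    x * x          ∎

  -1*-1≈1 : - 1# * - 1# ≈ 1#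
  -1*-1≈1 = trans (-x*-x≈x*x 1#) (*-identityˡ 1#)

  x*x≈1⇒x^n*x^n≈1 : ∀ {x} n → x * x ≈ 1# → x ^ n * x ^ n ≈ 1#
  x*x≈1⇒x^n*x^n≈1 {x} n x*x≈1 = begin
    x ^ n * x ^ n  ≈⟨ ^-distrib-* x x n ⟨
    (x * x) ^ n    ≈⟨ ^-congˡ n x*x≈1 ⟩
    1# ^ n         ≈⟨ 1^n≈1 n ⟩
    1#             ∎

  x^[2*n]≈x^n*x^n : ∀ x n → x ^ (2 ℕ.* n) ≈ x ^ n * x ^ n
  x^[2*n]≈x^n*x^n x n = trans (^-homo-* x n (n ℕ.+ 0)) (*-congˡ (^-congʳ x (ℕ.+-identityʳ n)))

  x^a≈y⇒x^[n*a]≈y^n : ∀ {x y a} n → x ^ a ≈ y → x ^ (n ℕ.* a) ≈ y ^ n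
  x^a≈y⇒x^[n*a]≈y^n {x} {y} {a} n x^a≈y = begin
    x ^ (n ℕ.* a)  ≡⟨ ≡.cong (x ^_) (ℕ.*-comm n a) ⟩
    x ^ (a ℕ.* n)  ≈⟨ ^-assocʳ x a n ⟨
    (x ^ a) ^ n    ≈⟨ ^-congˡ n x^a≈y ⟩
    y ^ n          ∎

  x^a≈-1⇒x^[2*a]≈1 : ∀ {x a} → x ^ a ≈ - 1# → x ^ (2 ℕ.* a) ≈ 1#
  x^a≈-1⇒x^[2*a]≈1 {x} {a} x^a≈-1 =
    trans (x^[2*n]≈x^n*x^n x a) (trans (*-cong x^a≈-1 x^a≈-1) -1*-1≈1)

  -- x ^ (1 + v b) = x (x ^ b) ^ v turns the relation into x (-1)^v ≈ (-1)^u; now square.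
  bézout-roots⇒x*x≈1 : ∀ {x a b u v} → x ^ a ≈ - 1# → x ^ b ≈ - 1# →
                       1 ℕ.+ v ℕ.* b ≡ u ℕ.* a → x * x ≈ 1#
  bézout-roots⇒x*x≈1 {x} {a} {b} {u} {v} x^a≈-1 x^b≈-1 eq = begin
    x * x                          ≈⟨ *-identityʳ (x * x) ⟨
    x * x * 1#                     ≈⟨ *-congˡ (x*x≈1⇒x^n*x^n≈1 v -1*-1≈1) ⟨
    x * x * (ε ^ v * ε ^ v)        ≈⟨ interchange x x (ε ^ v) (ε ^ v) ⟩
    x * ε ^ v * (x * ε ^ v)        ≈⟨ *-cong x*εᵛ≈εᵘ x*εᵛ≈εᵘ ⟩
    ε ^ u * ε ^ u                  ≈⟨ x*x≈1⇒x^n*x^n≈1 u -1*-1≈1 ⟩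
    1#                             ∎
    where
    ε = - 1#
    x*εᵛ≈εᵘ : x * ε ^ v ≈ ε ^ u
    x*εᵛ≈εᵘ = begin
      x * ε ^ v              ≈⟨ *-congˡ (x^a≈y⇒x^[n*a]≈y^n v x^b≈-1) ⟨
      x ^ (1 ℕ.+ v ℕ.* b)      ≡⟨ ≡.cong (x ^_) eq ⟩
      x ^ (u ℕ.* a)          ≈⟨ x^a≈y⇒x^[n*a]≈y^n u x^a≈-1 ⟩
      ε ^ u                  ∎

  x*x≈1⇒x^[2*t]≈-1⇒1+1≈0 : ∀ {x t} → x * x ≈ 1# → x ^ (2 ℕ.* t) ≈ - 1# → 1# + 1# ≈ 0#
  x*x≈1⇒x^[2*t]≈-1⇒1+1≈0 {x} {t} x*x≈1 x^2t≈-1 = begin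
    1# + 1#                ≈⟨ +-congʳ (x*x≈1⇒x^n*x^n≈1 t x*x≈1) ⟨
    x ^ t * x ^ t + 1#     ≈⟨ +-congʳ (x^[2*n]≈x^n*x^n x t) ⟨
    x ^ (2 ℕ.* t) + 1#     ≈⟨ +-congʳ x^2t≈-1 ⟩
    - 1# + 1#              ≈⟨ -‿inverseˡ 1# ⟩
    0#                     ∎

  coprime-roots⇒1+1≈0 : ∀ {x d l} → x ^ d ≈ - 1# → x ^ l ≈ - 1# →
                        gcd d l ≡ 1 → (l ℕ.+ d) ℕ.% 2 ≡ 1 → 1# + 1# ≈ 0#
  coprime-roots⇒1+1≈0 {x} {d} {l} x^d≈-1 x^l≈-1 gcd≡1 l+d-odd =
    [ (λ 2∣d → even-root⇒1+1≈0 2∣d x^d≈-1) , (λ 2∣l → even-root⇒1+1≈0 2∣l x^l≈-1) ]′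
      ([m+n]%2≡1⇒2∣n⊎2∣m l d l+d-odd)
    where
    x*x≈1 : x * x ≈ 1#
    x*x≈1 with coprime-Bézout (gcd≡1⇒coprime {d} {l} gcd≡1)
    ... | Bézout.+- u v eq = bézout-roots⇒x*x≈1 {u = u} {v} x^d≈-1 x^l≈-1 eq
    ... | Bézout.-+ u v eq = bézout-roots⇒x*x≈1 {u = v} {u} x^l≈-1 x^d≈-1 eq
    even-root⇒1+1≈0 : ∀ {a} → 2 ℕ.∣ a → x ^ a ≈ - 1# → 1# + 1# ≈ 0#
    even-root⇒1+1≈0 (ℕ.divides t a≡t*2) x^a≈-1 =
      x*x≈1⇒x^[2*t]≈-1⇒1+1≈0 {t = t} x*x≈1
        (trans (^-congʳ x (≡.trans (ℕ.*-comm 2 t) (≡.sym a≡t*2))) x^a≈-1)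

  x≈y∧y^n≈y⇒x^n≈x : ∀ {x y} n → x ≈ y → y ^ n ≈ y → x ^ n ≈ x
  x≈y∧y^n≈y⇒x^n≈x n x≈y y^n≈y = trans (^-congˡ n x≈y) (trans y^n≈y (sym x≈y))

  x*x*[x^a]^m≈x^[2+a*m] : ∀ x a m → x * x * (x ^ a) ^ m ≈ x ^ (2 ℕ.+ a ℕ.* m)
  x*x*[x^a]^m≈x^[2+a*m] x a m = trans (*-assoc x x _) (*-congˡ (*-congˡ (^-assocʳ x a m)))

  x^n≈1⇒x^[e+t*n]≈x^e : ∀ {x n} e t → x ^ n ≈ 1# → x ^ (e ℕ.+ t ℕ.* n) ≈ x ^ e
  x^n≈1⇒x^[e+t*n]≈x^e {x} {n} e t x^n≈1 = begin
    x ^ (e ℕ.+ t ℕ.* n)    ≈⟨ ^-homo-* x e (t ℕ.* n) ⟩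
    x ^ e * x ^ (t ℕ.* n)  ≈⟨ *-congˡ (x^a≈y⇒x^[n*a]≈y^n t x^n≈1) ⟩
    x ^ e * 1# ^ t         ≈⟨ *-congˡ (1^n≈1 t) ⟩
    x ^ e * 1#             ≈⟨ *-identityʳ (x ^ e) ⟩
    x ^ e                  ∎

  x^n≈1⇒x^m≈-1⇒x^e≈-1 : ∀ {x n m e} → m ℕ.+ e ≡ n → x ^ n ≈ 1# → x ^ m ≈ - 1# → x ^ e ≈ - 1#
  x^n≈1⇒x^m≈-1⇒x^e≈-1 {x} {n} {m} {e} m+e≡n x^n≈1 x^m≈-1 = begin
    x ^ e                      ≈⟨ *-identityˡ (x ^ e) ⟨
    1# * x ^ e                 ≈⟨ *-congʳ -1*-1≈1 ⟨
    - 1# * - 1# * x ^ e        ≈⟨ *-assoc (- 1#) (- 1#) (x ^ e) ⟩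
    - 1# * (- 1# * x ^ e)      ≈⟨ *-congˡ (*-congʳ x^m≈-1) ⟨
    - 1# * (x ^ m * x ^ e)     ≈⟨ *-congˡ (^-homo-* x m e) ⟨
    - 1# * x ^ (m ℕ.+ e)       ≡⟨ ≡.cong (λ k → - 1# * x ^ k) m+e≡n ⟩
    - 1# * x ^ n               ≈⟨ *-congˡ x^n≈1 ⟩
    - 1# * 1#                  ≈⟨ *-identityʳ (- 1#) ⟩
    - 1#                       ∎

  negExp-root⇒root : ∀ {x l d} → 1 ℕ.< l → gcd d l ≡ 1 →
                     x ^ l ≈ - 1# → x ^ negExp l d ≈ - 1# → x ^ d ≈ - 1#
  negExp-root⇒root {x} {l} {d} 1<l gcd≡1 x^l≈-1 x^m≈-1
    with e , t , m+e≡2l , d≡e+t*2l ← negExp-complement 1<l gcd≡1 = begin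
    x ^ d                      ≡⟨ ≡.cong (x ^_) d≡e+t*2l ⟩
    x ^ (e ℕ.+ t ℕ.* (2 ℕ.* l)) ≈⟨ x^n≈1⇒x^[e+t*n]≈x^e {n = 2 ℕ.* l} e t x^2l≈1 ⟩
    x ^ e                      ≈⟨ x^n≈1⇒x^m≈-1⇒x^e≈-1 {n = 2 ℕ.* l} {negExp l d} m+e≡2l x^2l≈1 x^m≈-1 ⟩
    - 1#                       ∎
    where
    x^2l≈1 : x ^ (2 ℕ.* l) ≈ 1#
    x^2l≈1 = x^a≈-1⇒x^[2*a]≈1 {a = l} x^l≈-1

module IntegersModulo (g : ℕ) where

  open import Data.Integer.Base using (ℤ; +_; 0ℤ; 1ℤ; -1ℤ; _+_; _*_; -_; _-_)
  import Data.Integer.Properties as ℤ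
  open import Data.Integer.Divisibility.Signed
    using (_∣_; divides; ∣m∣n⇒∣m+n; ∣m⇒∣-m; ∣m⇒∣m*n; ∣n⇒∣m*n; ∣ᵤ⇒∣; ∣⇒∣ᵤ)
  open import Data.Integer.Tactic.RingSolver using (solve-∀)

  infix 4 _≈_
  _≈_ : ℤ → ℤ → Set
  i ≈ j = + g ∣ i - j

  ≡⇒≈ : ∀ {i j} → i ≡ j → i ≈ j
  ≡⇒≈ {i} ≡.refl = divides 0ℤ (ℤ.+-inverseʳ i)

  ≈-trans : ∀ {i j k} → i ≈ j → j ≈ k → i ≈ k
  ≈-trans {i} {j} {k} i≈j j≈k = ≡.subst (+ g ∣_) (identity i j k) (∣m∣n⇒∣m+n i≈j j≈k)
    where
    identity : ∀ i j k → (i - j) + (j - k) ≡ i - k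
    identity = solve-∀

  ≈-sym : ∀ {i j} → i ≈ j → j ≈ i
  ≈-sym {i} {j} i≈j = ≡.subst (+ g ∣_) (identity i j) (∣m⇒∣-m i≈j)
    where
    identity : ∀ i j → - (i - j) ≡ j - i
    identity = solve-∀

  +-cong : ∀ {i j k l} → i ≈ j → k ≈ l → i + k ≈ j + l
  +-cong {i} {j} {k} {l} i≈j k≈l = ≡.subst (+ g ∣_) (identity i j k l) (∣m∣n⇒∣m+n i≈j k≈l)
    where
    identity : ∀ i j k l → (i - j) + (k - l) ≡ (i + k) - (j + l)
    identity = solve-∀

  *-cong : ∀ {i j k l} → i ≈ j → k ≈ l → i * k ≈ j * l
  *-cong {i} {j} {k} {l} i≈j k≈l =
    ≡.subst (+ g ∣_) (identity i j k l) (∣m∣n⇒∣m+n (∣m⇒∣m*n k i≈j) (∣n⇒∣m*n j k≈l))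
    where
    identity : ∀ i j k l → (i - j) * k + j * (k - l) ≡ i * k - j * l
    identity = solve-∀

  -‿cong : ∀ {i j} → i ≈ j → - i ≈ - j
  -‿cong {i} {j} i≈j = ≡.subst (+ g ∣_) (identity i j) (∣m⇒∣-m i≈j)
    where
    identity : ∀ i j → - (i - j) ≡ - i - - j
    identity = solve-∀

  commutativeRing : CommutativeRing 0ℓ 0ℓ
  commutativeRing = record
    { Carrier = ℤ
    ; _≈_ = _≈_
    ; _+_ = _+_
    ; _*_ = _*_
    ; -_ = -_
    ; 0# = 0ℤ
    ; 1# = 1ℤ
    ; isCommutativeRing = record
      { isRing = record
        { +-isAbelianGroup = record
          { isGroup = record
            { isMonoid = record
              { isSemigroup = record
                { isMagma = record
                  { isEquivalence = record
                    { refl = λ {i} → ≡⇒≈ {i} ≡.refl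
                    ; sym = λ {i j} → ≈-sym {i} {j}
                    ; trans = λ {i j k} → ≈-trans {i} {j} {k}
                    }
                  ; ∙-cong = λ {i j k l} → +-cong {i} {j} {k} {l}
                  }
                ; assoc = λ i j k → ≡⇒≈ (ℤ.+-assoc i j k)
                }
              ; identity = (λ i → ≡⇒≈ (ℤ.+-identityˡ i)) , (λ i → ≡⇒≈ (ℤ.+-identityʳ i))
              }
            ; inverse = (λ i → ≡⇒≈ (ℤ.+-inverseˡ i)) , (λ i → ≡⇒≈ (ℤ.+-inverseʳ i))
            ; ⁻¹-cong = λ {i j} → -‿cong {i} {j}
            }
          ; comm = λ i j → ≡⇒≈ (ℤ.+-comm i j)
          }
        ; *-cong = λ {i j k l} → *-cong {i} {j} {k} {l}
        ; *-assoc = λ i j k → ≡⇒≈ (ℤ.*-assoc i j k)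
        ; *-identity = (λ i → ≡⇒≈ (ℤ.*-identityˡ i)) , (λ i → ≡⇒≈ (ℤ.*-identityʳ i))
        ; distrib = (λ i j k → ≡⇒≈ (ℤ.*-distribˡ-+ i j k)) , (λ i j k → ≡⇒≈ (ℤ.*-distribʳ-+ i j k))
        }
      ; *-comm = λ i j → ≡⇒≈ (ℤ.*-comm i j)
      }
    }

  open RingLemmas commutativeRing using (_^_)

  +q^e≡+[q^e] : ∀ q e → (+ q) ^ e ≡ + (q ℕ.^ e)
  +q^e≡+[q^e] q zero = ≡.refl
  +q^e≡+[q^e] q (suc e) = ≡.trans (≡.cong (+ q *_) (+q^e≡+[q^e] q e)) (≡.sym (ℤ.pos-* q (q ℕ.^ e)))

  ∣q^e+1⇒q^e≈-1 : ∀ q e → g ℕ.∣ q ℕ.^ e ℕ.+ 1 → (+ q) ^ e ≈ -1ℤ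
  ∣q^e+1⇒q^e≈-1 q e g∣q^e+1 = ≡.subst (+ g ∣_) q^e+1≡q^e-[-1] (∣ᵤ⇒∣ g∣q^e+1)
    where
    q^e+1≡q^e-[-1] : + (q ℕ.^ e ℕ.+ 1) ≡ (+ q) ^ e - -1ℤ
    q^e+1≡q^e-[-1] = ≡.trans (ℤ.pos-+ (q ℕ.^ e) 1) (≡.cong (_+ 1ℤ) (≡.sym (+q^e≡+[q^e] q e)))

  1+1≈0⇒∣2 : 1ℤ + 1ℤ ≈ 0ℤ → g ℕ.∣ 2
  1+1≈0⇒∣2 = ∣⇒∣ᵤ

module PowersPlusOne where

  open import Data.Nat using (_+_; _*_; _^_; _%_; _<_)
  open import Data.Nat.Divisibility using (_∣_; ∣-antisym)
  open import Data.Integer.Base using (+_)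

  common-divisor∣2 : ∀ q d l → gcd d l ≡ 1 → (l + d) % 2 ≡ 1 →
                     ∀ {g} → g ∣ q ^ d + 1 → g ∣ q ^ l + 1 → g ∣ 2
  common-divisor∣2 q d l gcd≡1 l+d-odd {g} g∣q^d+1 g∣q^l+1 = 1+1≈0⇒∣2
    (coprime-roots⇒1+1≈0 {+ q} {d} {l} (∣q^e+1⇒q^e≈-1 q d g∣q^d+1) (∣q^e+1⇒q^e≈-1 q l g∣q^l+1) gcd≡1 l+d-odd)
    where
    open IntegersModulo g
    open RingLemmas commutativeRing

  negExp-common-divisor∣2 : ∀ q d l → 1 < l → gcd d l ≡ 1 → (l + d) % 2 ≡ 1 →
                            ∀ {g} → g ∣ q ^ negExp l d + 1 → g ∣ q ^ l + 1 → g ∣ 2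
  negExp-common-divisor∣2 q d l 1<l gcd≡1 l+d-odd {g} g∣q^m+1 g∣q^l+1 = 1+1≈0⇒∣2
    (coprime-roots⇒1+1≈0 {+ q} {d} {l} (negExp-root⇒root {+ q} {l} {d} 1<l gcd≡1 q^l≈-1 q^m≈-1)
                         q^l≈-1 gcd≡1 l+d-odd)
    where
    open IntegersModulo g
    open RingLemmas commutativeRing
    q^l≈-1 = ∣q^e+1⇒q^e≈-1 q l g∣q^l+1
    q^m≈-1 = ∣q^e+1⇒q^e≈-1 q (negExp l d) g∣q^m+1

  gcd[q^a+1,q^b+1]≡2 : ∀ {q} a b → q % 2 ≡ 1 → (∀ {g} → g ∣ q ^ a + 1 → g ∣ q ^ b + 1 → g ∣ 2) →
                       gcd (q ^ a + 1) (q ^ b + 1) ≡ 2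
  gcd[q^a+1,q^b+1]≡2 {q} a b q-odd common∣2 = ∣-antisym
    (common∣2 (gcd[m,n]∣m (q ^ a + 1) (q ^ b + 1)) (gcd[m,n]∣n (q ^ a + 1) (q ^ b + 1)))
    (gcd-greatest (%2≡1⇒2∣[m+1] {q ^ a} (^%2≡1 a q-odd)) (%2≡1⇒2∣[m+1] {q ^ b} (^%2≡1 b q-odd)))

module FieldLemmas {c ℓ} (F : Field c ℓ) where

  open Field F hiding (_^_)
  open RingLemmas commRing
  open import Relation.Binary.Reasoning.Setoid setoid

  x≉0⇒x⁻¹*x≈1 : ∀ {x} → x ≉ 0# → x ⁻¹ * x ≈ 1#
  x≉0⇒x⁻¹*x≈1 {x} x≉0 = trans (*-comm (x ⁻¹) x) (⁻¹-inverse x x≉0)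

  x*y≈0⇒x≈0 : ∀ {x y} → y ≉ 0# → x * y ≈ 0# → x ≈ 0#
  x*y≈0⇒x≈0 {x} {y} y≉0 x*y≈0 = begin
    x                  ≈⟨ *-identityʳ x ⟨
    x * 1#             ≈⟨ *-congˡ (⁻¹-inverse y y≉0) ⟨
    x * (y * y ⁻¹)     ≈⟨ *-assoc x y (y ⁻¹) ⟨
    x * y * y ⁻¹       ≈⟨ *-congʳ x*y≈0 ⟩
    0# * y ⁻¹          ≈⟨ zeroˡ (y ⁻¹) ⟩
    0#                 ∎

  x≉0∧y≉0⇒x*y≉0 : ∀ {x y} → x ≉ 0# → y ≉ 0# → x * y ≉ 0#
  x≉0∧y≉0⇒x*y≉0 x≉0 y≉0 x*y≈0 = x≉0 (x*y≈0⇒x≈0 y≉0 x*y≈0)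

  x≉0⇒x^n≉0 : ∀ {x} n → x ≉ 0# → x ^ n ≉ 0#
  x≉0⇒x^n≉0 zero x≉0 = 1≉0
  x≉0⇒x^n≉0 (suc n) x≉0 = x≉0∧y≉0⇒x*y≉0 x≉0 (x≉0⇒x^n≉0 n x≉0)

  x≉0⇒x⁻¹≉0 : ∀ {x} → x ≉ 0# → x ⁻¹ ≉ 0#
  x≉0⇒x⁻¹≉0 {x} x≉0 x⁻¹≈0 = 1≉0 (begin
    1#            ≈⟨ ⁻¹-inverse x x≉0 ⟨
    x * x ⁻¹      ≈⟨ *-congˡ x⁻¹≈0 ⟩
    x * 0#        ≈⟨ zeroʳ x ⟩
    0#            ∎)

  nonsquare⇒≉0 : ∀ {x} → NonSquare F x → x ≉ 0#
  nonsquare⇒≉0 x-nonsquare x≈0 = x-nonsquare (0# , trans (zeroˡ 0#) (sym x≈0))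

  x*x≈a∧a≉0⇒x≉0 : ∀ {x a} → x * x ≈ a → a ≉ 0# → x ≉ 0#
  x*x≈a∧a≉0⇒x≉0 {x} x*x≈a a≉0 x≈0 = a≉0 (trans (sym x*x≈a) (trans (*-congʳ x≈0) (zeroˡ x)))

  x*[a*x⁻¹]≈a : ∀ {x} a → x ≉ 0# → x * (a * x ⁻¹) ≈ a
  x*[a*x⁻¹]≈a {x} a x≉0 = begin
    x * (a * x ⁻¹)   ≈⟨ *-congˡ (*-comm a (x ⁻¹)) ⟩
    x * (x ⁻¹ * a)   ≈⟨ *-assoc x (x ⁻¹) a ⟨
    x * x ⁻¹ * a     ≈⟨ *-congʳ (⁻¹-inverse x x≉0) ⟩
    1# * a           ≈⟨ *-identityˡ a ⟩
    a                ∎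

  x*y≈a⇒y≈a*x⁻¹ : ∀ {x y a} → x ≉ 0# → x * y ≈ a → y ≈ a * x ⁻¹
  x*y≈a⇒y≈a*x⁻¹ {x} {y} {a} x≉0 x*y≈a = begin
    y                ≈⟨ *-identityˡ y ⟨
    1# * y           ≈⟨ *-congʳ (x≉0⇒x⁻¹*x≈1 x≉0) ⟨
    x ⁻¹ * x * y     ≈⟨ *-assoc (x ⁻¹) x y ⟩
    x ⁻¹ * (x * y)   ≈⟨ *-congˡ x*y≈a ⟩
    x ⁻¹ * a         ≈⟨ *-comm (x ⁻¹) a ⟩
    a * x ⁻¹         ∎

  x*y⁻¹*y≈x : ∀ {x y} → y ≉ 0# → x * y ⁻¹ * y ≈ x
  x*y⁻¹*y≈x {x} {y} y≉0 = begin
    x * y ⁻¹ * y     ≈⟨ *-assoc x (y ⁻¹) y ⟩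
    x * (y ⁻¹ * y)   ≈⟨ *-congˡ (x≉0⇒x⁻¹*x≈1 y≉0) ⟩
    x * 1#           ≈⟨ *-identityʳ x ⟩
    x                ∎

  x*[x^r]⁻¹*[x^[1+a]]^[r+1]≈x^[2+a*[r+1]] : ∀ {x} r a → x ≉ 0# →
    x * (x ^ r) ⁻¹ * (x ^ suc a) ^ (r ℕ.+ 1) ≈ x ^ (2 ℕ.+ a ℕ.* (r ℕ.+ 1))
  x*[x^r]⁻¹*[x^[1+a]]^[r+1]≈x^[2+a*[r+1]] {x} r a x≉0 = begin
    x * (x ^ r) ⁻¹ * (x ^ suc a) ^ (r ℕ.+ 1)     ≈⟨ *-congˡ (^-assocʳ x (suc a) (r ℕ.+ 1)) ⟩
    x * (x ^ r) ⁻¹ * x ^ (suc a ℕ.* (r ℕ.+ 1))   ≡⟨ ≡.cong (λ e → x * (x ^ r) ⁻¹ * x ^ e) (exponent r a) ⟩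
    x * (x ^ r) ⁻¹ * x ^ (r ℕ.+ suc m)          ≈⟨ *-congˡ (^-homo-* x r (suc m)) ⟩
    x * (x ^ r) ⁻¹ * (x ^ r * x ^ suc m)        ≈⟨ *-assoc (x * (x ^ r) ⁻¹) (x ^ r) (x ^ suc m) ⟨
    x * (x ^ r) ⁻¹ * x ^ r * x ^ suc m          ≈⟨ *-congʳ (x*y⁻¹*y≈x (x≉0⇒x^n≉0 r x≉0)) ⟩
    x * x ^ suc m                               ∎
    where
    m = a ℕ.* (r ℕ.+ 1)
    exponent : ∀ r a → suc a ℕ.* (r ℕ.+ 1) ≡ r ℕ.+ suc (a ℕ.* (r ℕ.+ 1))
    exponent = ℕ-Solver.solve-∀

module InvolutionProducts
  {α c ℓ} {A : Set α} (_≟_ : DecidableEquality A) (R : CommutativeSemiring c ℓ) where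

  open CommutativeSemiring R
  open import Algebra.Properties.Semiring.Exp semiring using (_^_)
  open import Algebra.Properties.CommutativeSemigroup *-commutativeSemigroup using (x∙yz≈y∙xz)
  open import Relation.Binary.Reasoning.Setoid setoid

  ∏ : (A → Carrier) → List A → Carrier
  ∏ f [] = 1#
  ∏ f (x ∷ xs) = f x * ∏ f xs

  remove : A → List A → List A
  remove y [] = []
  remove y (x ∷ xs) with x ≟ y
  ... | yes _ = xs
  ... | no _ = x ∷ remove y xs

  module _ {y : A} where

    ∏-remove : ∀ f {xs} → y ∈ xs → ∏ f xs ≈ f y * ∏ f (remove y xs)
    ∏-remove f {x ∷ xs} y∈x∷xs with x ≟ y | y∈x∷xs
    ... | yes ≡.refl | _ = refl
    ... | no x≢y | here y≡x = contradiction (≡.sym y≡x) x≢y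
    ... | no _ | there y∈xs = trans (*-congˡ (∏-remove f y∈xs)) (x∙yz≈y∙xz (f x) (f y) _)

    length-remove : ∀ {xs} → y ∈ xs → length xs ≡ suc (length (remove y xs))
    length-remove {x ∷ xs} y∈x∷xs with x ≟ y | y∈x∷xs
    ... | yes _ | _ = ≡.refl
    ... | no x≢y | here y≡x = contradiction (≡.sym y≡x) x≢y
    ... | no _ | there y∈xs = ≡.cong suc (length-remove y∈xs)

    ∈-remove⁻ : ∀ {z xs} → z ∈ remove y xs → z ∈ xs
    ∈-remove⁻ {xs = x ∷ xs} z∈ with x ≟ y | z∈
    ... | yes _ | z∈xs = there z∈xs
    ... | no _ | here z≡x = here z≡x
    ... | no _ | there z∈xs = there (∈-remove⁻ z∈xs)

    ∈-remove⁺ : ∀ {z xs} → z ∈ xs → z ≢ y → z ∈ remove y xs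
    ∈-remove⁺ {xs = x ∷ xs} z∈x∷xs z≢y with x ≟ y | z∈x∷xs
    ... | yes ≡.refl | here z≡x = contradiction z≡x z≢y
    ... | yes _ | there z∈xs = z∈xs
    ... | no _ | here z≡x = here z≡x
    ... | no _ | there z∈xs = there (∈-remove⁺ z∈xs z≢y)

    ∉-remove : ∀ {xs} → Unique xs → y ∉ remove y xs
    ∉-remove {x ∷ xs} (x∉xs ∷ xs!) y∈ with x ≟ y | y∈
    ... | yes ≡.refl | y∈xs = All.lookup x∉xs y∈xs ≡.refl
    ... | no x≢y | here y≡x = x≢y (≡.sym y≡x)
    ... | no _ | there y∈xs = ∉-remove xs! y∈xs

    remove⁺ : ∀ {xs} → Unique xs → Unique (remove y xs)
    remove⁺ {[]} [] = []
    remove⁺ {x ∷ xs} (x∉xs ∷ xs!) with x ≟ y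
    ... | yes _ = xs!
    ... | no _ = All.tabulate (λ z∈ → All.lookup x∉xs (∈-remove⁻ z∈)) ∷ remove⁺ xs!

  ∏-pair : ∀ f {s s′ xs} → Unique xs → s ≢ s′ → s ∈ xs → s′ ∈ xs →
           (∀ {z} → z ∈ xs → z ≡ s ⊎ z ≡ s′) → ∏ f xs ≈ f s * f s′ × length xs ≡ 2
  ∏-pair f {s} {s′} {xs} xs! s≢s′ s∈xs s′∈xs only = ∏≈ , |xs|≡2
    where
    s′∈xs∖s : s′ ∈ remove s xs
    s′∈xs∖s = ∈-remove⁺ s′∈xs (λ s′≡s → s≢s′ (≡.sym s′≡s))
    empty : ∀ {ys} → (∀ {z} → z ∉ ys) → ys ≡ []
    empty {[]} _ = ≡.refl
    empty {_ ∷ _} no-member = contradiction (here ≡.refl) no-member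
    rest≡[] : remove s′ (remove s xs) ≡ []
    rest≡[] = empty λ {z} z∈rest →
      [ (λ z≡s → ∉-remove xs! (≡.subst (_∈ remove s xs) z≡s (∈-remove⁻ z∈rest)))
      , (λ z≡s′ → ∉-remove (remove⁺ xs!) (≡.subst (_∈ remove s′ (remove s xs)) z≡s′ z∈rest))
      ]′ (only (∈-remove⁻ (∈-remove⁻ z∈rest)))
    ∏≈ : ∏ f xs ≈ f s * f s′
    ∏≈ = begin
      ∏ f xs                                      ≈⟨ ∏-remove f s∈xs ⟩
      f s * ∏ f (remove s xs)                     ≈⟨ *-congˡ (∏-remove f s′∈xs∖s) ⟩
      f s * (f s′ * ∏ f (remove s′ (remove s xs))) ≡⟨ ≡.cong (λ ys → f s * (f s′ * ∏ f ys)) rest≡[] ⟩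
      f s * (f s′ * 1#)                           ≈⟨ *-congˡ (*-identityʳ (f s′)) ⟩
      f s * f s′                                  ∎
    |xs|≡2 : length xs ≡ 2
    |xs|≡2 = ≡.trans (length-remove s∈xs)
               (≡.cong suc (≡.trans (length-remove s′∈xs∖s) (≡.cong (suc ∘ length) rest≡[])))

  module Pairing (ι : A → A) (f : A → Carrier) (a : Carrier) where

    fixedPoints : List A → List A
    fixedPoints = filter (λ x → ι x ≟ x)

    record IsPairedOn (xs : List A) : Set (α ⊔ ℓ) where
      field
        unique     : Unique xs
        closed     : ∀ {x} → x ∈ xs → ι x ∈ xs
        involutive : ∀ {x} → x ∈ xs → ι (ι x) ≡ x
        paired     : ∀ {x} → x ∈ xs → ι x ≢ x → f x * f (ι x) ≈ a

    fixedPoints-remove : ∀ {y} xs → ι y ≢ y → fixedPoints (remove y xs) ≡ fixedPoints xs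
    fixedPoints-remove [] _ = ≡.refl
    fixedPoints-remove {y} (x ∷ xs) ιy≢y with x ≟ y
    ... | yes ≡.refl = ≡.sym (filter-reject (λ x → ι x ≟ x) ιy≢y)
    ... | no _ with ι x ≟ x
    ...   | yes _ = ≡.cong (x ∷_) (fixedPoints-remove xs ιy≢y)
    ...   | no _ = fixedPoints-remove xs ιy≢y

    PairedProduct : List A → Set ℓ
    PairedProduct xs = ∃ λ k → ∏ f xs ≈ a ^ k * ∏ f (fixedPoints xs)
                             × 2 ℕ.* k ℕ.+ length (fixedPoints xs) ≡ length xs

    module _ {x xs} (p : IsPairedOn (x ∷ xs)) where

      open IsPairedOn p

      x∉xs : x ∉ xs
      x∉xs x∈xs = All.lookup (AllPairs.head unique) x∈xs ≡.refl

      ι-cancel : ∀ {z w} → z ∈ x ∷ xs → w ∈ x ∷ xs → ι z ≡ ι w → z ≡ w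
      ι-cancel z∈ w∈ ιz≡ιw = ≡.trans (≡.sym (involutive z∈)) (≡.trans (≡.cong ι ιz≡ιw) (involutive w∈))

      restrict-fixed : ι x ≡ x → IsPairedOn xs
      restrict-fixed ιx≡x = record
        { unique = AllPairs.tail unique
        ; closed = closed′
        ; involutive = involutive ∘ there
        ; paired = paired ∘ there
        }
        where
        closed′ : ∀ {z} → z ∈ xs → ι z ∈ xs
        closed′ z∈xs with closed (there z∈xs)
        ... | here ιz≡x = contradiction
          (≡.subst (_∈ xs) (ι-cancel (there z∈xs) (here ≡.refl) (≡.trans ιz≡x (≡.sym ιx≡x))) z∈xs) x∉xs
        ... | there ιz∈xs = ιz∈xs

      ιx∈xs : ι x ≢ x → ι x ∈ xs
      ιx∈xs ιx≢x with closed (here ≡.refl)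
      ... | here ιx≡x = contradiction ιx≡x ιx≢x
      ... | there ιx∈xs = ιx∈xs

      restrict-moved : ι x ≢ x → IsPairedOn (remove (ι x) xs)
      restrict-moved ιx≢x = record
        { unique = remove⁺ (AllPairs.tail unique)
        ; closed = closed′
        ; involutive = involutive ∘ there ∘ ∈-remove⁻
        ; paired = paired ∘ there ∘ ∈-remove⁻
        }
        where
        closed′ : ∀ {z} → z ∈ remove (ι x) xs → ι z ∈ remove (ι x) xs
        closed′ {z} z∈rest with z∈xs ← ∈-remove⁻ z∈rest | closed (there z∈xs)
        ... | here ιz≡x = contradiction
          (≡.subst (_∈ remove (ι x) xs) (≡.trans (≡.sym (involutive (there z∈xs))) (≡.cong ι ιz≡x)) z∈rest)
          (∉-remove (AllPairs.tail unique))
        ... | there ιz∈xs = ∈-remove⁺ ιz∈xs λ ιz≡ιx →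
          x∉xs (≡.subst (_∈ xs) (ι-cancel (there z∈xs) (here ≡.refl) ιz≡ιx) z∈xs)

      moved-step : ι x ≢ x → PairedProduct (remove (ι x) xs) →
                   ∃ λ k → f x * ∏ f xs ≈ a ^ k * ∏ f (fixedPoints xs)
                         × 2 ℕ.* k ℕ.+ length (fixedPoints xs) ≡ suc (length xs)
      moved-step ιx≢x (k , ∏≈ , |fp|≡) = suc k , ∏≈′ , |fp|≡′
        where
        rest = remove (ι x) xs
        ιx∈ = ιx∈xs ιx≢x
        fp≡ : fixedPoints rest ≡ fixedPoints xs
        fp≡ = fixedPoints-remove xs λ ιιx≡ιx →
          ιx≢x (≡.sym (≡.trans (≡.sym (involutive (here ≡.refl))) ιιx≡ιx))
        ∏≈′ : f x * ∏ f xs ≈ a * a ^ k * ∏ f (fixedPoints xs)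
        ∏≈′ = begin
          f x * ∏ f xs                         ≈⟨ *-congˡ (∏-remove f ιx∈) ⟩
          f x * (f (ι x) * ∏ f rest)           ≈⟨ *-assoc (f x) (f (ι x)) _ ⟨
          f x * f (ι x) * ∏ f rest             ≈⟨ *-congʳ (paired (here ≡.refl) ιx≢x) ⟩
          a * ∏ f rest                         ≈⟨ *-congˡ ∏≈ ⟩
          a * (a ^ k * ∏ f (fixedPoints rest)) ≈⟨ *-assoc a (a ^ k) _ ⟨
          a * a ^ k * ∏ f (fixedPoints rest)   ≡⟨ ≡.cong (λ ys → a * a ^ k * ∏ f ys) fp≡ ⟩
          a * a ^ k * ∏ f (fixedPoints xs)     ∎
        double-suc : ∀ k m → 2 ℕ.* suc k ℕ.+ m ≡ suc (suc (2 ℕ.* k ℕ.+ m))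
        double-suc = ℕ-Solver.solve-∀
        |fp|≡′ : 2 ℕ.* suc k ℕ.+ length (fixedPoints xs) ≡ suc (length xs)
        |fp|≡′ = ≡.trans (double-suc k _) (≡.cong suc (≡.trans
                   (≡.cong suc (≡.trans (≡.cong (λ ys → 2 ℕ.* k ℕ.+ length ys) (≡.sym fp≡)) |fp|≡))
                   (≡.sym (length-remove ιx∈))))

    pairedProduct : ∀ xs → IsPairedOn xs → PairedProduct xs
    pairedProduct xs = bounded (length xs) xs ℕ.≤-refl
      where
      bounded : ∀ N xs → length xs ℕ.≤ N → IsPairedOn xs → PairedProduct xs
      bounded _ [] _ _ = 0 , sym (*-identityˡ 1#) , ≡.refl
      bounded (suc N) (x ∷ xs) (s≤s |xs|≤N) p with ι x ≟ x
      ... | yes ιx≡x with k , ∏≈ , |fp|≡ ← bounded N xs |xs|≤N (restrict-fixed p ιx≡x) =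
        k , trans (*-congˡ ∏≈) (x∙yz≈y∙xz (f x) (a ^ k) _)
          , ≡.trans (ℕ.+-suc (2 ℕ.* k) _) (≡.cong suc |fp|≡)
      ... | no ιx≢x = moved-step p ιx≢x (bounded N (remove (ι x) xs) |rest|≤N (restrict-moved p ιx≢x))
        where
        |rest|≤N : length (remove (ι x) xs) ℕ.≤ N
        |rest|≤N = ℕ.≤-trans (ℕ.n≤1+n _) (≡.subst (ℕ._≤ N) (length-remove (ιx∈xs p ιx≢x)) |xs|≤N)

    pairedProduct-fixedPointFree : ∀ xs → IsPairedOn xs → (∀ {x} → x ∈ xs → ι x ≢ x) →
                                   ∃ λ k → ∏ f xs ≈ a ^ k × 2 ℕ.* k ≡ length xs
    pairedProduct-fixedPointFree xs p moves
      with k , ∏≈ , |fp|≡ ← pairedProduct xs p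
      rewrite filter-none (λ x → ι x ≟ x) (All.tabulate moves) =
      k , trans ∏≈ (*-identityʳ (a ^ k)) , ≡.trans (≡.sym (ℕ.+-identityʳ (2 ℕ.* k))) |fp|≡

module FiniteField {c ℓ} (F : Field c ℓ) {t : ℕ} (card : HasCard F (suc (2 ℕ.* t))) where

  open Field F hiding (_^_)
  open RingLemmas commRing
  open FieldLemmas F
  open import Algebra.Properties.Ring ring
    using (-‿distribʳ-*; -‿involutive; -‿injective; -0#≈0#; +-identityʳ-unique; +-inverseˡ-unique;
           x∙y⁻¹≈ε⇒x≈y; x[y-z]≈xy-xz)
  open import Algebra.Properties.CommutativeSemiring.Exp commutativeSemiring using (^-distrib-*)
  open Inverse card using (to; from; to-cong; from-cong; strictlyInverseˡ; strictlyInverseʳ)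
  open import Relation.Binary.Reasoning.Setoid setoid

  private
    n = suc (2 ℕ.* t)

  open InvolutionProducts (Fin._≟_ {n}) commutativeSemiring

  from∘to : ∀ x → from (to x) ≈ x
  from∘to = strictlyInverseʳ

  ≈from⇒to≡ : ∀ {x i} → x ≈ from i → to x ≡ i
  ≈from⇒to≡ {x} {i} x≈from-i = ≡.trans (to-cong x≈from-i) (strictlyInverseˡ i)

  from≈⇒≡to : ∀ {x i} → from i ≈ x → i ≡ to x
  from≈⇒≡to {x} {i} from-i≈x = ≡.trans (≡.sym (strictlyInverseˡ i)) (to-cong from-i≈x)

  infix 4 _≈?_
  _≈?_ : ∀ x y → Dec (x ≈ y)
  x ≈? y = Dec.map′ (λ to≡ → trans (sym (from∘to x)) (trans (from-cong to≡) (from∘to y))) to-cong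
                    (to x Fin.≟ to y)

  square? : ∀ x → Dec (∃ λ y → y * y ≈ x)
  square? x = Dec.map′ (λ (i , i*i≈x) → from i , i*i≈x)
                       (λ (y , y*y≈x) → to y , trans (*-cong (from∘to y) (from∘to y)) y*y≈x)
                       (Fin.any? λ i → from i * from i ≈? x)

  length-allFin : length (allFin n) ≡ n
  length-allFin = length-tabulate id

  -- x ↦ x + 1 would be a fixed-point-free involution, pairing off the odd number of elements.
  1+1≉0 : 1# + 1# ≉ 0#
  1+1≉0 1+1≈0 = ℕ.even≢odd k t (≡.trans 2k≡|allFin| length-allFin)
    where
    ι : Fin n → Fin n
    ι i = to (from i + 1#)
    from-ι : ∀ i → from (ι i) ≈ from i + 1#
    from-ι i = from∘to (from i + 1#)
    ι-involutive : ∀ i → ι (ι i) ≡ i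
    ι-involutive i = ≈from⇒to≡ (begin
      from (ι i) + 1#     ≈⟨ +-congʳ (from-ι i) ⟩
      from i + 1# + 1#    ≈⟨ +-assoc (from i) 1# 1# ⟩
      from i + (1# + 1#)  ≈⟨ +-congˡ 1+1≈0 ⟩
      from i + 0#         ≈⟨ +-identityʳ (from i) ⟩
      from i              ∎)
    ι-moves : ∀ i → ι i ≢ i
    ι-moves i ιi≡i = 1≉0 (+-identityʳ-unique (from i) 1# (trans (sym (from-ι i)) (from-cong ιi≡i)))
    open Pairing ι (λ _ → 1#) 1#
    isPairedOn : IsPairedOn (allFin n)
    isPairedOn = record
      { unique = allFin⁺ n
      ; closed = λ _ → ∈-allFin _
      ; involutive = λ {i} _ → ι-involutive i
      ; paired = λ _ _ → *-identityˡ 1#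
      }
    fixedPointFree = pairedProduct-fixedPointFree (allFin n) isPairedOn (λ {i} _ → ι-moves i)
    k = proj₁ fixedPointFree
    2k≡|allFin| = proj₂ (proj₂ fixedPointFree)

  nonzero : List (Fin n)
  nonzero = remove (to 0#) (allFin n)

  nonzero-unique : Unique nonzero
  nonzero-unique = remove⁺ (allFin⁺ n)

  ∈nonzero⁻ : ∀ {i} → i ∈ nonzero → from i ≉ 0#
  ∈nonzero⁻ i∈nonzero from-i≈0 =
    ∉-remove (allFin⁺ n) (≡.subst (_∈ nonzero) (from≈⇒≡to from-i≈0) i∈nonzero)

  ∈nonzero⁺ : ∀ {i} → from i ≉ 0# → i ∈ nonzero
  ∈nonzero⁺ from-i≉0 = ∈-remove⁺ (∈-allFin _) λ i≡to0 → from-i≉0 (trans (from-cong i≡to0) (from∘to 0#))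

  length-nonzero : length nonzero ≡ 2 ℕ.* t
  length-nonzero =
    ≡.sym (ℕ.suc-injective (≡.trans (≡.sym length-allFin) (length-remove (∈-allFin (to 0#)))))

  module Inversion {a} (a≉0 : a ≉ 0#) where

    ι : Fin n → Fin n
    ι i = to (a * from i ⁻¹)

    from-i*from-ιi≈a : ∀ {i} → i ∈ nonzero → from i * from (ι i) ≈ a
    from-i*from-ιi≈a {i} i∈nonzero = trans (*-congˡ (from∘to _)) (x*[a*x⁻¹]≈a a (∈nonzero⁻ i∈nonzero))

    fixed⇒square : ∀ {i} → i ∈ nonzero → ι i ≡ i → from i * from i ≈ a
    fixed⇒square i∈nonzero ιi≡i = trans (*-congˡ (from-cong (≡.sym ιi≡i))) (from-i*from-ιi≈a i∈nonzero)

    square⇒fixed : ∀ {i} → i ∈ nonzero → from i * from i ≈ a → ι i ≡ i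
    square⇒fixed i∈nonzero i*i≈a = ≈from⇒to≡ (sym (x*y≈a⇒y≈a*x⁻¹ (∈nonzero⁻ i∈nonzero) i*i≈a))

    open Pairing ι from a public

    isPairedOn : IsPairedOn nonzero
    isPairedOn = record
      { unique = nonzero-unique
      ; closed = λ {i} i∈nonzero → ∈nonzero⁺ λ from-ιi≈0 →
          x≉0∧y≉0⇒x*y≉0 a≉0 (x≉0⇒x⁻¹≉0 (∈nonzero⁻ i∈nonzero)) (trans (sym (from∘to _)) from-ιi≈0)
      ; involutive = λ {i} i∈nonzero → ≈from⇒to≡ (sym (x*y≈a⇒y≈a*x⁻¹
          (λ from-ιi≈0 → a≉0 (trans (sym (from-i*from-ιi≈a i∈nonzero))
                                     (trans (*-congˡ from-ιi≈0) (zeroʳ (from i)))))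
          (trans (*-comm _ _) (from-i*from-ιi≈a i∈nonzero))))
      ; paired = λ i∈nonzero _ → from-i*from-ιi≈a i∈nonzero
      }

  ∏nonzero≈a^t : ∀ {a} → NonSquare F a → ∏ from nonzero ≈ a ^ t
  ∏nonzero≈a^t {a} a-nonsquare = trans ∏≈a^k (reflexive (≡.cong (a ^_) k≡t))
    where
    open Inversion (nonsquare⇒≉0 a-nonsquare)
    fixedPointFree = pairedProduct-fixedPointFree nonzero isPairedOn λ i∈nonzero ιi≡i →
      a-nonsquare (_ , fixed⇒square i∈nonzero ιi≡i)
    k = proj₁ fixedPointFree
    ∏≈a^k = proj₁ (proj₂ fixedPointFree)
    k≡t : k ≡ t
    k≡t = ℕ.*-cancelˡ-≡ k t 2 (≡.trans (proj₂ (proj₂ fixedPointFree)) length-nonzero)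

  x≉0⇒x≉-x : ∀ {x} → x ≉ 0# → x ≉ - x
  x≉0⇒x≉-x {x} x≉0 x≈-x = x≉0∧y≉0⇒x*y≉0 1+1≉0 x≉0 (begin
    (1# + 1#) * x      ≈⟨ distribʳ x 1# 1# ⟩
    1# * x + 1# * x    ≈⟨ +-cong (*-identityˡ x) (*-identityˡ x) ⟩
    x + x              ≈⟨ +-congʳ x≈-x ⟩
    - x + x            ≈⟨ -‿inverseˡ x ⟩
    0#                 ∎)

  x*x≈s*s⇒x≈s⊎x≈-s : ∀ {x s} → x * x ≈ s * s → x ≈ s ⊎ x ≈ - s
  x*x≈s*s⇒x≈s⊎x≈-s {x} {s} x*x≈s*s with x ≈? s
  ... | yes x≈s = inj₁ x≈s
  ... | no x≉s = inj₂ (+-inverseˡ-unique x s (x*y≈0⇒x≈0 x-s≉0 [x+s][x-s]≈0))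
    where
    x-s≉0 : x - s ≉ 0#
    x-s≉0 x-s≈0 = x≉s (x∙y⁻¹≈ε⇒x≈y x s x-s≈0)
    [x+s][x-s]≈0 : (x + s) * (x - s) ≈ 0#
    [x+s][x-s]≈0 = begin
      (x + s) * (x - s)                  ≈⟨ x[y-z]≈xy-xz (x + s) x s ⟩
      (x + s) * x - (x + s) * s          ≈⟨ +-cong (distribʳ x x s) (-‿cong (distribʳ s x s)) ⟩
      (x * x + s * x) - (x * s + s * s)  ≈⟨ +-congʳ (+-cong x*x≈s*s (*-comm s x)) ⟩
      (s * s + x * s) - (x * s + s * s)  ≈⟨ +-congʳ (+-comm (s * s) (x * s)) ⟩
      (x * s + s * s) - (x * s + s * s)  ≈⟨ -‿inverseʳ (x * s + s * s) ⟩
      0#                                 ∎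

  ∏nonzero≈-[s*s]^t : ∀ {s} → s ≉ 0# → ∏ from nonzero ≈ - ((s * s) ^ t)
  ∏nonzero≈-[s*s]^t {s} s≉0 = begin
    ∏ from nonzero                              ≈⟨ ∏≈ ⟩
    (s * s) ^ k * ∏ from (fixedPoints nonzero)  ≈⟨ *-congˡ ∏fixed≈ ⟩
    (s * s) ^ k * (s * - s)                     ≈⟨ *-congˡ (-‿distribʳ-* s s) ⟨
    (s * s) ^ k * - (s * s)                     ≈⟨ -‿distribʳ-* ((s * s) ^ k) (s * s) ⟨
    - ((s * s) ^ k * (s * s))                   ≈⟨ -‿cong (*-comm ((s * s) ^ k) (s * s)) ⟩
    - ((s * s) ^ suc k)                         ≡⟨ ≡.cong (λ e → - ((s * s) ^ e)) 1+k≡t ⟩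
    - ((s * s) ^ t)                             ∎
    where
    open Inversion (x≉0∧y≉0⇒x*y≉0 s≉0 s≉0)
    paired = pairedProduct nonzero isPairedOn
    k = proj₁ paired
    ∏≈ = proj₁ (proj₂ paired)
    to-∈fixedPoints : ∀ {x} → x ≉ 0# → x * x ≈ s * s → to x ∈ fixedPoints nonzero
    to-∈fixedPoints {x} x≉0 x*x≈s*s = ∈-filter⁺ (λ i → ι i Fin.≟ i) to-x∈nonzero
      (square⇒fixed to-x∈nonzero (trans (*-cong (from∘to x) (from∘to x)) x*x≈s*s))
      where
      to-x∈nonzero = ∈nonzero⁺ λ from-to-x≈0 → x≉0 (trans (sym (from∘to x)) from-to-x≈0)
    fixedPoints-only : ∀ {i} → i ∈ fixedPoints nonzero → i ≡ to s ⊎ i ≡ to (- s)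
    fixedPoints-only i∈fixedPoints with i∈nonzero , ιi≡i ← ∈-filter⁻ (λ i → ι i Fin.≟ i) i∈fixedPoints =
      Sum.map from≈⇒≡to from≈⇒≡to (x*x≈s*s⇒x≈s⊎x≈-s (fixed⇒square i∈nonzero ιi≡i))
    to-s≢to-[-s] : to s ≢ to (- s)
    to-s≢to-[-s] to-s≡to-[-s] = x≉0⇒x≉-x s≉0
      (trans (sym (from∘to s)) (trans (from-cong to-s≡to-[-s]) (from∘to (- s))))
    -s≉0 : - s ≉ 0#
    -s≉0 -s≈0 = s≉0 (trans (sym (-‿involutive s)) (trans (-‿cong -s≈0) -0#≈0#))
    two = ∏-pair from (filter⁺ (λ i → ι i Fin.≟ i) nonzero-unique) to-s≢to-[-s]
            (to-∈fixedPoints s≉0 refl) (to-∈fixedPoints -s≉0 (-x*-x≈x*x s)) fixedPoints-only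
    ∏fixed≈ : ∏ from (fixedPoints nonzero) ≈ s * - s
    ∏fixed≈ = trans (proj₁ two) (*-cong (from∘to s) (from∘to (- s)))
    1+k≡t : suc k ≡ t
    1+k≡t = ℕ.*-cancelˡ-≡ (suc k) t 2 (≡.trans (double-suc k)
      (≡.trans (≡.cong (2 ℕ.* k ℕ.+_) (≡.sym (proj₂ two)))
        (≡.trans (proj₂ (proj₂ paired)) length-nonzero)))
      where
      double-suc : ∀ k → 2 ℕ.* suc k ≡ 2 ℕ.* k ℕ.+ 2
      double-suc = ℕ-Solver.solve-∀

  ∏nonzero≈-1 : ∏ from nonzero ≈ - 1#
  ∏nonzero≈-1 = trans (∏nonzero≈-[s*s]^t 1≉0) (-‿cong (trans (^-congˡ t (*-identityˡ 1#)) (1^n≈1 t)))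

  nonsquare^t≈-1 : ∀ {a} → NonSquare F a → a ^ t ≈ - 1#
  nonsquare^t≈-1 a-nonsquare = trans (sym (∏nonzero≈a^t a-nonsquare)) ∏nonzero≈-1

  [s*s]^t≈1 : ∀ {s} → s ≉ 0# → (s * s) ^ t ≈ 1#
  [s*s]^t≈1 s≉0 = -‿injective (trans (sym (∏nonzero≈-[s*s]^t s≉0)) ∏nonzero≈-1)

  x^[2t]≈1 : ∀ {x} → x ≉ 0# → x ^ (2 ℕ.* t) ≈ 1#
  x^[2t]≈1 {x} x≉0 with square? x
  ... | no x-nonsquare = x^a≈-1⇒x^[2*a]≈1 {a = t} (nonsquare^t≈-1 x-nonsquare)
  ... | yes (s , s*s≈x) = trans (x^[2*n]≈x^n*x^n x t) (trans (*-cong x^t≈1 x^t≈1) (*-identityˡ 1#))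
    where
    x^t≈1 : x ^ t ≈ 1#
    x^t≈1 = trans (^-congˡ t (sym s*s≈x)) ([s*s]^t≈1 (x*x≈a∧a≉0⇒x≉0 s*s≈x x≉0))

  nonsquare*nonsquare⁻¹-square : ∀ {β β′} → NonSquare F β → NonSquare F β′ → ∃ λ s → s * s ≈ β′ * β ⁻¹
  nonsquare*nonsquare⁻¹-square {β} {β′} β-nonsquare β′-nonsquare with square? (β′ * β ⁻¹)
  ... | yes square = square
  ... | no quotient-nonsquare = contradiction (trans (+-congʳ 1≈-1) (-‿inverseˡ 1#)) 1+1≉0
    where
    1≈-1 : 1# ≈ - 1#
    1≈-1 = begin
      1#                               ≈⟨ -1*-1≈1 ⟨
      - 1# * - 1#
        ≈⟨ *-cong (nonsquare^t≈-1 quotient-nonsquare) (nonsquare^t≈-1 β-nonsquare) ⟨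
      (β′ * β ⁻¹) ^ t * β ^ t          ≈⟨ ^-distrib-* (β′ * β ⁻¹) β t ⟨
      (β′ * β ⁻¹ * β) ^ t              ≈⟨ ^-congˡ t (x*y⁻¹*y≈x (nonsquare⇒≉0 β-nonsquare)) ⟩
      β′ ^ t                           ≈⟨ nonsquare^t≈-1 β′-nonsquare ⟩
      - 1#                             ∎

  x^[k*[Y+1]]^Y≈x^[k*[Y+1]] : ∀ {x} Y k → Y ℕ.* Y ≡ n → x ≉ 0# →
                              (x ^ (k ℕ.* (Y ℕ.+ 1))) ^ Y ≈ x ^ (k ℕ.* (Y ℕ.+ 1))
  x^[k*[Y+1]]^Y≈x^[k*[Y+1]] {x} Y k Y*Y≡n x≉0 = begin
    (x ^ e) ^ Y                ≈⟨ ^-assocʳ x e Y ⟩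
    x ^ (e ℕ.* Y)              ≡⟨ ≡.cong (x ^_) e*Y≡e+k*2t ⟩
    x ^ (e ℕ.+ k ℕ.* (2 ℕ.* t)) ≈⟨ x^n≈1⇒x^[e+t*n]≈x^e e k (x^[2t]≈1 x≉0) ⟩
    x ^ e                      ∎
    where
    e = k ℕ.* (Y ℕ.+ 1)
    expand : ∀ k Y → k ℕ.* (Y ℕ.+ 1) ℕ.* Y ≡ k ℕ.* (Y ℕ.* Y) ℕ.+ k ℕ.* Y
    expand = ℕ-Solver.solve-∀
    regroup : ∀ k Y u → k ℕ.* suc u ℕ.+ k ℕ.* Y ≡ k ℕ.* (Y ℕ.+ 1) ℕ.+ k ℕ.* u
    regroup = ℕ-Solver.solve-∀
    e*Y≡e+k*2t : e ℕ.* Y ≡ e ℕ.+ k ℕ.* (2 ℕ.* t)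
    e*Y≡e+k*2t =
      ≡.trans (expand k Y) (≡.trans (≡.cong (λ m → k ℕ.* m ℕ.+ k ℕ.* Y) Y*Y≡n) (regroup k Y (2 ℕ.* t)))

  fixed-β′*β⁻¹*b^[r+1] : ∀ {β β′} → NonSquare F β → NonSquare F β′ → ∀ r {Y} → Y ℕ.* Y ≡ n →
    gcd (r ℕ.+ 1) (Y ℕ.+ 1) ≡ 2 →
    ∃ λ b → b ≉ 0# × (β′ * β ⁻¹ * b ^ (r ℕ.+ 1)) ^ Y ≈ β′ * β ⁻¹ * b ^ (r ℕ.+ 1)
  fixed-β′*β⁻¹*b^[r+1] {β} {β′} β-nonsquare β′-nonsquare r {Y} Y*Y≡n gcd≡2
    with s , s*s≈β′*β⁻¹ ← nonsquare*nonsquare⁻¹-square β-nonsquare β′-nonsquare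
       | a , k , 2+a*[r+1]≡k*[Y+1] ← gcd[m,n+1]≡g⇒g+a*m≡k*[n+1] (r ℕ.+ 1) Y gcd≡2 =
    s ^ a , x≉0⇒x^n≉0 a s≉0 , x≈y∧y^n≈y⇒x^n≈x Y β′*β⁻¹*[s^a]^[r+1]≈s^[k*[Y+1]]
      (x^[k*[Y+1]]^Y≈x^[k*[Y+1]] Y k Y*Y≡n s≉0)
    where
    s≉0 : s ≉ 0#
    s≉0 = x*x≈a∧a≉0⇒x≉0 s*s≈β′*β⁻¹
      (x≉0∧y≉0⇒x*y≉0 (nonsquare⇒≉0 β′-nonsquare) (x≉0⇒x⁻¹≉0 (nonsquare⇒≉0 β-nonsquare)))
    β′*β⁻¹*[s^a]^[r+1]≈s^[k*[Y+1]] : β′ * β ⁻¹ * (s ^ a) ^ (r ℕ.+ 1) ≈ s ^ (k ℕ.* (Y ℕ.+ 1))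
    β′*β⁻¹*[s^a]^[r+1]≈s^[k*[Y+1]] = begin
      β′ * β ⁻¹ * (s ^ a) ^ (r ℕ.+ 1)  ≈⟨ *-congʳ s*s≈β′*β⁻¹ ⟨
      s * s * (s ^ a) ^ (r ℕ.+ 1)      ≈⟨ x*x*[x^a]^m≈x^[2+a*m] s a (r ℕ.+ 1) ⟩
      s ^ (2 ℕ.+ a ℕ.* (r ℕ.+ 1))       ≡⟨ ≡.cong (s ^_) 2+a*[r+1]≡k*[Y+1] ⟩
      s ^ (k ℕ.* (Y ℕ.+ 1))            ∎

  fixed-β*[β^r]⁻¹*b^[r+1] : ∀ {β} → NonSquare F β → ∀ r {Y} → Y ℕ.* Y ≡ n →
    gcd (r ℕ.+ 1) (Y ℕ.+ 1) ≡ 2 →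
    ∃ λ b → b ≉ 0# × (β * (β ^ r) ⁻¹ * b ^ (r ℕ.+ 1)) ^ Y ≈ β * (β ^ r) ⁻¹ * b ^ (r ℕ.+ 1)
  fixed-β*[β^r]⁻¹*b^[r+1] {β} β-nonsquare r {Y} Y*Y≡n gcd≡2
    with a , k , 2+a*[r+1]≡k*[Y+1] ← gcd[m,n+1]≡g⇒g+a*m≡k*[n+1] (r ℕ.+ 1) Y gcd≡2 =
    β ^ suc a , x≉0⇒x^n≉0 (suc a) β≉0 , x≈y∧y^n≈y⇒x^n≈x Y β*[β^r]⁻¹*[β^[1+a]]^[r+1]≈β^[k*[Y+1]]
      (x^[k*[Y+1]]^Y≈x^[k*[Y+1]] Y k Y*Y≡n β≉0)
    where
    β≉0 = nonsquare⇒≉0 β-nonsquare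
    β*[β^r]⁻¹*[β^[1+a]]^[r+1]≈β^[k*[Y+1]] :
      β * (β ^ r) ⁻¹ * (β ^ suc a) ^ (r ℕ.+ 1) ≈ β ^ (k ℕ.* (Y ℕ.+ 1))
    β*[β^r]⁻¹*[β^[1+a]]^[r+1]≈β^[k*[Y+1]] =
      trans (x*[x^r]⁻¹*[x^[1+a]]^[r+1]≈x^[2+a*[r+1]] r a β≉0)
            (reflexive (≡.cong (β ^_) 2+a*[r+1]≡k*[Y+1]))

open import Data.Nat using (_+_; _*_; _^_; _%_; _/_; _<_)
open import Data.Nat.Primality using (Prime)
open PowersPlusOne

lemma2p1 : ∀ {c ℓ} (p h l d : ℕ) → Prime p → p % 2 ≡ 1 → 0 < h → 1 < l
    → (F : Field c ℓ) → HasCard F ((p ^ h) ^ (2 * l))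
    → (β β′ : Field.Carrier F) → NonSquare F β → NonSquare F β′
    → 0 < d → gcd d l ≡ 1 → (l + d) % 2 ≡ 1
    → (gcd ((p ^ h) ^ d + 1) ((p ^ h) ^ l + 1) ≡ 2)
      × ∃ λ b₀ → ∃ λ b₁ → ¬ (Field._≈_ F b₀ (Field.0# F)) × ¬ (Field._≈_ F b₁ (Field.0# F))
        × InSub F (p ^ h) l
            (Field._*_ F (Field._*_ F β′ (Field._⁻¹ F β)) (Field._^_ F b₀ ((p ^ h) ^ d + 1)))
        × InSub F (p ^ h) l
            (Field._*_ F (Field._*_ F β (Field._⁻¹ F (Field._^_ F β ((p ^ h) ^ negExp l d))))
                         (Field._^_ F b₁ ((p ^ h) ^ negExp l d + 1)))
lemma2p1 p h l d _ p-odd _ 1<l F card β β′ β-nonsquare β′-nonsquare _ gcd≡1 l+d-odd =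
  let b₀ , b₀≉0 , fixed₀ = fixed-β′*β⁻¹*b^[r+1] β-nonsquare β′-nonsquare (q ^ d) q^l*q^l≡|F| gcd₀
      b₁ , b₁≉0 , fixed₁ = fixed-β*[β^r]⁻¹*b^[r+1] β-nonsquare (q ^ negExp l d) q^l*q^l≡|F| gcd₁
  in gcd₀ , b₀ , b₁ , b₀≉0 , b₁≉0 , fixed₀ , fixed₁
  where
  q = p ^ h
  q-odd : q % 2 ≡ 1
  q-odd = ^%2≡1 h p-odd
  gcd₀ : gcd (q ^ d + 1) (q ^ l + 1) ≡ 2
  gcd₀ = gcd[q^a+1,q^b+1]≡2 d l q-odd (common-divisor∣2 q d l gcd≡1 l+d-odd)
  gcd₁ : gcd (q ^ negExp l d + 1) (q ^ l + 1) ≡ 2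
  gcd₁ = gcd[q^a+1,q^b+1]≡2 (negExp l d) l q-odd (negExp-common-divisor∣2 q d l 1<l gcd≡1 l+d-odd)
  |F|≡1+2t : q ^ (2 * l) ≡ suc (2 * (q ^ (2 * l) / 2))
  |F|≡1+2t = %2≡1⇒≡1+2*[m/2] (^%2≡1 (2 * l) q-odd)
  q^l*q^l≡|F| : q ^ l * q ^ l ≡ suc (2 * (q ^ (2 * l) / 2))
  q^l*q^l≡|F| = ≡.trans (≡.sym (ℕ.^-distribˡ-+-* q l l))
                        (≡.trans (≡.cong (λ e → q ^ (l + e)) (≡.sym (ℕ.+-identityʳ l))) |F|≡1+2t)
  open FiniteField F {q ^ (2 * l) / 2} (≡.subst (HasCard F) |F|≡1+2t card)
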